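{- Let $r\ge 2$ and $n\ge 3$, and let $GT^{(n)}_r$ be the $n$-th generalized glued binary tree of depth $r$. Then $\mu_{\rm t}(GT^{(n)}_r)=\mu_{\rm d}(GT^{(n)}_r)=2^{r-1}$, the numbers of $\mu_{\rm t}$-sets and of $\mu_{\rm d}$-sets of $GT^{(n)}_r$ are both $2^{2^{r-1}}$, and ${\rm gp}_{\rm t}(GT^{(n)}_r)={\rm gp}_{\rm d}(GT^{(n)}_r)=0$.
   Context: A perfect binary tree of depth $r$ is a rooted tree in which every non-leaf vertex has exactly 2 children and all leaves have depth $r$. $GT^{(n)}_r$ is obtained from $n$ copies $T_r^{(1)},\dots,T_r^{(n)}$ of the perfect binary tree of depth $r$ by identifying, for each leaf position, the corresponding leaves of all $n$ copies (under the natural isomorphisms) into a single vertex. For $S\subseteq V(G)$: $u,v$ are $S$-visible if some shortest $u,v$-path $P$ has $V(P)\cap S\subseteq\{u,v\}$, and $S$-positionable if every shortest $u,v$-path $P$ has $V(P)\cap S\subseteq\{u,v\}$. $S$ is a mutual-visibility (resp. general position) set if all pairs in $S$ are $S$-visible (resp. $S$-positionable); it is dual if moreover all pairs in $V(G)\setminus S$ are $S$-visible (resp. $S$-positionable); it is total if all pairs of vertices of $G$ are $S$-visible (resp. $S$-positionable). $\mu_{\rm d},\mu_{\rm t},{\rm gp}_{\rm d},{\rm gp}_{\rm t}$ denote the maximum sizes of dual/total mutual-visibility and dual/total general position sets, and $\mu_{\rm d}$-sets, $\mu_{\rm t}$-sets are such sets of maximum size. -}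

module Defs where

open import Data.Nat using (ℕ; zero; suc; _+_; _≤_; _<_)
open import Data.Fin using (Fin)
open import Data.Bool using (Bool; true; false)
open import Data.List using (List; []; _∷_; length)
open import Data.List.Membership.Propositional using (_∈_)
open import Data.List.Relation.Unary.Any using (Any)
open import Data.List.Relation.Unary.Unique.Propositional using (Unique)
open import Data.List.Relation.Unary.AllPairs using (AllPairs)
open import Data.Product using (Σ; Σ-syntax; ∃; ∃-syntax; _×_; _,_)
open import Data.Sum using (_⊎_)
open import Relation.Binary.PropositionalEquality using (_≡_; _≢_)
open import Function.Bundles using (_⇔_)

-- A vertex of the perfect binary tree of depth r is addressed by the
-- word w ∈ {0,1}* (of length = its depth) of left/right choices read
-- from the vertex upwards to the root (the children of w are b ∷ w).
-- Non-leaf vertices (depth < r) exist once per copy i ∈ Fin n; leaves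
-- (depth = r) are shared by all copies (this is the gluing).

module _ (n r : ℕ) where

  data Vtx : Set where
    inner : (i : Fin n) (w : List Bool) → .(length w < r) → Vtx
    leaf  : (w : List Bool) → .(length w ≡ r) → Vtx

  data Child : Vtx → Vtx → Set where
    inner-inner : ∀ i w b .(p : length w < r) .(q : length (b ∷ w) < r) →
                  Child (inner i w p) (inner i (b ∷ w) q)
    inner-leaf  : ∀ i w b .(p : length w < r) .(q : length (b ∷ w) ≡ r) →
                  Child (inner i w p) (leaf (b ∷ w) q)

  Adj : Vtx → Vtx → Set
  Adj u v = Child u v ⊎ Child v u

  data Walk : Vtx → Vtx → Set where
    []  : ∀ {u} → Walk u u
    _∷_ : ∀ {u v w} → Adj u v → Walk v w → Walk u w

  len : ∀ {u v} → Walk u v → ℕ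
  len []      = 0
  len (_ ∷ P) = suc (len P)

  verts : ∀ {u v} → Walk u v → List Vtx
  verts {u} []      = u ∷ []
  verts {u} (_ ∷ P) = u ∷ verts P

  IsShortest : ∀ {u v} → Walk u v → Set
  IsShortest {u} {v} P = (Q : Walk u v) → len P ≤ len Q

  VSet : Set
  VSet = Vtx → Bool

  _∈S_ : Vtx → VSet → Set
  x ∈S S = S x ≡ true

  Avoids : VSet → ∀ {u v} → Walk u v → Set
  Avoids S {u} {v} P = ∀ x → x ∈ verts P → x ∈S S → (x ≡ u ⊎ x ≡ v)

  Visible : VSet → Vtx → Vtx → Set
  Visible S u v = Σ[ P ∈ Walk u v ] (IsShortest P × Avoids S P)

  Positionable : VSet → Vtx → Vtx → Set
  Positionable S u v = (P : Walk u v) → IsShortest P → Avoids S P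

  InS : (Vtx → Vtx → Set) → VSet → Set
  InS R S = ∀ u v → u ∈S S → v ∈S S → R u v

  OutS : (Vtx → Vtx → Set) → VSet → Set
  OutS R S = ∀ u v → S u ≡ false → S v ≡ false → R u v

  AllP : (Vtx → Vtx → Set) → Set
  AllP R = ∀ u v → R u v

  IsDualMV IsTotalMV IsDualGP IsTotalGP : VSet → Set
  IsDualMV  S = InS (Visible S) S × OutS (Visible S) S
  IsTotalMV S = AllP (Visible S)
  IsDualGP  S = InS (Positionable S) S × OutS (Positionable S) S
  IsTotalGP S = AllP (Positionable S)

  HasSize : VSet → ℕ → Set
  HasSize S k = Σ[ xs ∈ List Vtx ]
    (length xs ≡ k × Unique xs × (∀ x → (x ∈S S) ⇔ (x ∈ xs)))

  MaxSize : (VSet → Set) → ℕ → Set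
  MaxSize P k = (Σ[ S ∈ VSet ] (P S × HasSize S k))
              × (∀ S m → P S → HasSize S m → m ≤ k)

  SameSet : VSet → VSet → Set
  SameSet S T = ∀ x → S x ≡ T x

  NumSets : (VSet → Set) → ℕ → ℕ → Set
  NumSets P k c = Σ[ Ls ∈ List VSet ]
    (length Ls ≡ c
    × AllPairs (λ S T → ∃[ x ] S x ≢ T x) Ls
    × (∀ S → (P S × HasSize S k) ⇔ Any (SameSet S) Ls))

{-# OPTIONS --safe #-}
module Submission where

-- If S is a dual mutual-visibility set, two vertices with the same membership in S are S-visible, so
-- they cannot be at distance 2 or 3 with every geodesic between them running through a vertex of S.
-- Around an inner vertex x ∈ S (its parent, children and sibling, and its copies in the other trees)
-- such a pair always exists, so S contains no inner vertex; and two copies of a leaf parent show that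
-- S never contains two sibling leaves. Conversely every such set is a total mutual-visibility set,
-- because the interior leaves of a geodesic can be replaced by their siblings. So the largest such
-- sets are the transversals picking one leaf below each of the 2^(r-1) leaf parents, and there are
-- 2^(2^(r-1)) of them. A dual general-position set is a dual mutual-visibility set, hence consists of
-- leaves, and a leaf in it would lie inside the geodesic between two of its parents: it is empty.

open import Defs
open import Data.Bool using (Bool; true; false; not; _xor_)
open import Data.Bool.Properties using (not-¬; ¬-not; not-involutive) renaming (_≟_ to _≟ᵇ_)
open import Data.Empty using (⊥-elim)
open import Data.Fin using (Fin; zero; suc) renaming (_≟_ to _≟ᶠ_)
open import Data.List using (List; []; _∷_; length; map; _++_; allFin; upTo; concatMap; cartesianProduct)
open import Data.List.Properties as List
  using (∷-injectiveˡ; ∷-injectiveʳ; length-removeAt′; length-map; length-++)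
open import Data.List.Membership.Propositional using (_∈_; lose; find)
open import Data.List.Membership.Propositional.Properties
open import Data.List.Relation.Binary.Subset.Propositional using (_⊆_)
open import Data.List.Relation.Unary.All as All using (All; []; _∷_)
open import Data.List.Relation.Unary.Any using (Any; here; there; any?; _─_)
import Data.List.Relation.Unary.AllPairs as AllPairs
import Data.List.Relation.Unary.AllPairs.Properties as AllPairs
open import Data.List.Relation.Unary.Unique.Propositional using (Unique; []; _∷_)
import Data.List.Relation.Unary.Unique.Propositional.Properties as Unique
open import Data.Nat using (ℕ; zero; suc; _+_; _*_; _^_; _∸_; _≤_; _<_; z≤n; s≤s; s≤s⁻¹; _<?_)
  renaming (_≟_ to _≟ⁿ_)
open import Data.Nat.Properties
  using ( ≤-refl; ≤-reflexive; ≤-antisym; <⇒≤; <⇒≢; ≮⇒≥; <-irrefl; <-≤-trans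
        ; m≤n+m; m≢1+n+m; suc-injective; +-suc; +-identityʳ; m∸n+n≡m; ^-distribˡ-+-*; anyUpTo? )
open import Data.Product using (Σ-syntax; ∃-syntax; _×_; _,_; proj₁; proj₂)
import Data.Product.Properties as Product
open import Data.Sum using (_⊎_; inj₁; inj₂; [_,_]′)
open import Function using (_∘_; id)
open import Function.Bundles using (mk⇔; Equivalence)
open Equivalence using (to; from)
open import Relation.Binary.Definitions using (DecidableEquality)
open import Relation.Binary.PropositionalEquality
open import Relation.Nullary using (¬_; Dec; yes; no; does; contradiction)
open import Relation.Nullary.Decidable using (_×-dec_; _⊎-dec_; recompute; dec-true; dec-false)
open import Relation.Unary using (Decidable)

least-witness : ∀ {P : ℕ → Set} → Decidable P → ∀ {m} → P m →
  ∃[ k ] P k × (∀ {j} → j < k → ¬ P j)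
least-witness {P} P? {m} pm = search (suc m) (m , ≤-refl , pm)
  where
  search : ∀ m → (∃[ j ] j < m × P j) → ∃[ k ] P k × (∀ {j} → j < k → ¬ P j)
  search (suc m) below-1+m with anyUpTo? P? m
  ... | yes below-m = search m below-m
  ... | no none with below-1+m
  ...   | j , j<1+m , pj = j , pj , λ i<j pi → none (_ , <-≤-trans i<j (s≤s⁻¹ j<1+m) , pi)

∈-─⁺ : ∀ {A : Set} {x z : A} {ys} (x∈ys : x ∈ ys) → z ∈ ys → z ≢ x → z ∈ (ys ─ x∈ys)
∈-─⁺ (here refl)  (here refl)  z≢x = contradiction refl z≢x
∈-─⁺ (here refl)  (there z∈ys) _   = z∈ys
∈-─⁺ (there _)    (here refl)  _   = here refl
∈-─⁺ (there x∈ys) (there z∈ys) z≢x = there (∈-─⁺ x∈ys z∈ys z≢x)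

unique-⊆⇒length≤ : ∀ {A : Set} {xs ys : List A} → Unique xs → xs ⊆ ys → length xs ≤ length ys
unique-⊆⇒length≤ {xs = []}     _             _     = z≤n
unique-⊆⇒length≤ {xs = x ∷ xs} {ys} (x≢xs ∷ xs!) xs⊆ys =
  subst (suc (length xs) ≤_) (sym (length-removeAt′ ys _))
    (s≤s (unique-⊆⇒length≤ xs! λ z∈xs →
      ∈-─⁺ x∈ys (xs⊆ys (there z∈xs)) (λ { refl → All.lookup x≢xs z∈xs refl })))
  where
  x∈ys = xs⊆ys (here refl)

≢∧≢⇒≡ : ∀ {x y z : Bool} → x ≢ y → y ≢ z → x ≡ z
≢∧≢⇒≡ x≢y y≢z = trans (¬-not x≢y) (sym (¬-not (≢-sym y≢z)))

b∧not-b⇒all : ∀ {P : Bool → Set} b → P b → P (not b) → ∀ c → P c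
b∧not-b⇒all false P-b _    false = P-b
b∧not-b⇒all false _   P-¬b true  = P-¬b
b∧not-b⇒all true  _   P-¬b false = P-¬b
b∧not-b⇒all true  P-b _    true  = P-b

≟ᵇ-true⇒≡ : ∀ {b c} → does (b ≟ᵇ c) ≡ true → b ≡ c
≟ᵇ-true⇒≡ {false} {false} _ = refl
≟ᵇ-true⇒≡ {true}  {true}  _ = refl

parity : ℕ → Bool
parity zero    = false
parity (suc m) = not (parity m)

words : ℕ → List (List Bool)
words zero    = [] ∷ []
words (suc d) = map (false ∷_) (words d) ++ map (true ∷_) (words d)

∈-words : ∀ w → w ∈ words (length w)
∈-words []          = here refl
∈-words (false ∷ w) = ∈-++⁺ˡ (∈-map⁺ (false ∷_) (∈-words w))
∈-words (true ∷ w)  = ∈-++⁺ʳ (map (false ∷_) (words (length w))) (∈-map⁺ (true ∷_) (∈-words w))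

words-length : ∀ d {w} → w ∈ words d → length w ≡ d
words-length zero    (here refl) = refl
words-length (suc d) w∈ with ∈-++⁻ (map (false ∷_) (words d)) w∈
... | inj₁ w∈₀ with ∈-map⁻ (false ∷_) w∈₀
...   | _ , v∈ , refl = cong suc (words-length d v∈)
words-length (suc d) w∈ | inj₂ w∈₁ with ∈-map⁻ (true ∷_) w∈₁
...   | _ , v∈ , refl = cong suc (words-length d v∈)

length-words : ∀ d → length (words d) ≡ 2 ^ d
length-words zero    = refl
length-words (suc d) = begin
  length (map (false ∷_) (words d) ++ map (true ∷_) (words d))
    ≡⟨ length-++ (map (false ∷_) (words d)) ⟩
  length (map (false ∷_) (words d)) + length (map (true ∷_) (words d))
    ≡⟨ cong₂ _+_ (length-map _ (words d)) (length-map _ (words d)) ⟩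
  length (words d) + length (words d)
    ≡⟨ cong (λ m → m + m) (length-words d) ⟩
  2 ^ d + 2 ^ d
    ≡⟨ cong (2 ^ d +_) (sym (+-identityʳ (2 ^ d))) ⟩
  2 ^ suc d ∎
  where open ≡-Reasoning

words-unique : ∀ d → Unique (words d)
words-unique zero    = [] ∷ []
words-unique (suc d) =
  Unique.++⁺ (Unique.map⁺ ∷-injectiveʳ (words-unique d)) (Unique.map⁺ ∷-injectiveʳ (words-unique d))
    disjoint
  where
  disjoint : ∀ {w} → ¬ (w ∈ map (false ∷_) (words d) × w ∈ map (true ∷_) (words d))
  disjoint (w∈₀ , w∈₁) with ∈-map⁻ (false ∷_) w∈₀ | ∈-map⁻ (true ∷_) w∈₁
  ... | _ , _ , refl | _ , _ , ()

BoolTree : ℕ → Set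
BoolTree zero    = Bool
BoolTree (suc d) = BoolTree d × BoolTree d

label : ∀ {d} → BoolTree d → List Bool → Bool
label {zero}  b        _           = b
label {suc d} (t , _)  []          = label t []
label {suc d} (t₀ , _) (false ∷ w) = label t₀ w
label {suc d} (_ , t₁) (true ∷ w)  = label t₁ w

tabulate : ∀ d → ((w : List Bool) → .(length w ≡ d) → Bool) → BoolTree d
tabulate zero    f = f [] refl
tabulate (suc d) f =
  tabulate d (λ w q → f (false ∷ w) (cong suc q)) , tabulate d (λ w q → f (true ∷ w) (cong suc q))

label-tabulate : ∀ d f w (q : length w ≡ d) → label (tabulate d f) w ≡ f w q
label-tabulate zero    f []          _ = refl
label-tabulate (suc d) f (false ∷ w) q = label-tabulate d _ w (suc-injective q)
label-tabulate (suc d) f (true ∷ w)  q = label-tabulate d _ w (suc-injective q)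

_≟ᵗ_ : ∀ {d} → DecidableEquality (BoolTree d)
_≟ᵗ_ {zero}  = _≟ᵇ_
_≟ᵗ_ {suc d} = Product.≡-dec _≟ᵗ_ _≟ᵗ_

label-≢ : ∀ {d} {t t′ : BoolTree d} → t ≢ t′ → ∃[ w ] length w ≡ d × label t w ≢ label t′ w
label-≢ {zero} t≢t′ = [] , refl , t≢t′
label-≢ {suc d} {t₀ , _} {t₀′ , _} t≢t′ with t₀ ≟ᵗ t₀′
... | yes refl  = let w , q , labels≢ = label-≢ (t≢t′ ∘ cong (t₀ ,_)) in true ∷ w , cong suc q , labels≢
... | no t₀≢t₀′ = let w , q , labels≢ = label-≢ t₀≢t₀′                in false ∷ w , cong suc q , labels≢

trees : ∀ d → List (BoolTree d)
trees zero    = false ∷ true ∷ []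
trees (suc d) = cartesianProduct (trees d) (trees d)

∈-trees : ∀ {d} (t : BoolTree d) → t ∈ trees d
∈-trees {zero}  false     = here refl
∈-trees {zero}  true      = there (here refl)
∈-trees {suc d} (t₀ , t₁) = ∈-cartesianProduct⁺ (∈-trees t₀) (∈-trees t₁)

trees-unique : ∀ d → Unique (trees d)
trees-unique zero    = ((λ ()) ∷ []) ∷ [] ∷ []
trees-unique (suc d) = Unique.cartesianProduct⁺ (trees-unique d) (trees-unique d)

length-cartesianProduct : ∀ {A B : Set} (xs : List A) (ys : List B) →
  length (cartesianProduct xs ys) ≡ length xs * length ys
length-cartesianProduct []       ys = refl
length-cartesianProduct (x ∷ xs) ys = begin
  length (map (x ,_) ys ++ cartesianProduct xs ys)
    ≡⟨ length-++ (map (x ,_) ys) ⟩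
  length (map (x ,_) ys) + length (cartesianProduct xs ys)
    ≡⟨ cong₂ _+_ (length-map _ ys) (length-cartesianProduct xs ys) ⟩
  length ys + length xs * length ys ∎
  where open ≡-Reasoning

length-trees : ∀ d → length (trees d) ≡ 2 ^ 2 ^ d
length-trees zero    = refl
length-trees (suc d) = begin
  length (cartesianProduct (trees d) (trees d)) ≡⟨ length-cartesianProduct (trees d) (trees d) ⟩
  length (trees d) * length (trees d)           ≡⟨ cong (λ m → m * m) (length-trees d) ⟩
  2 ^ 2 ^ d * 2 ^ 2 ^ d                         ≡⟨ sym (^-distribˡ-+-* 2 (2 ^ d) (2 ^ d)) ⟩
  2 ^ (2 ^ d + 2 ^ d)
    ≡⟨ cong (λ m → 2 ^ (2 ^ d + m)) (sym (+-identityʳ (2 ^ d))) ⟩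
  2 ^ 2 ^ suc d                                 ∎
  where open ≡-Reasoning

pattern ↓inner = inj₁ (inner-inner _ _ _ _ _)
pattern ↓leaf  = inj₁ (inner-leaf _ _ _ _ _)
pattern ↑inner = inj₂ (inner-inner _ _ _ _ _)
pattern ↑leaf  = inj₂ (inner-leaf _ _ _ _ _)

module GluedTree (n r : ℕ) where

  V : Set
  V = Vtx n r

  infix 4 _~_
  _~_ : V → V → Set
  _~_ = Adj n r

  word : V → List Bool
  word (inner _ w _) = w
  word (leaf w _)    = w

  depth : V → ℕ
  depth x = length (word x)

  child-depth : ∀ {u v} → Child n r u v → depth v ≡ suc (depth u)
  child-depth (inner-inner _ _ _ _ _) = refl
  child-depth (inner-leaf _ _ _ _ _)  = refl

  grandchild-≢ : ∀ {g x c} → Child n r g x → Child n r x c → g ≢ c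
  grandchild-≢ {g} g→x x→c refl =
    m≢1+n+m (depth g) {1} (trans (child-depth x→c) (cong suc (child-depth g→x)))

  colour : V → Bool
  colour x = parity (depth x)

  child-colour : ∀ {u v} → Child n r u v → colour v ≡ not (colour u)
  child-colour = cong parity ∘ child-depth

  ~-colour : ∀ {u v} → u ~ v → colour v ≡ not (colour u)
  ~-colour (inj₁ c) = child-colour c
  ~-colour (inj₂ c) = sym (trans (cong not (child-colour c)) (not-involutive _))

  ~-sym : ∀ {u v} → u ~ v → v ~ u
  ~-sym (inj₁ c) = inj₂ c
  ~-sym (inj₂ c) = inj₁ c

  same-colour⇒≁ : ∀ {u v} → colour u ≡ colour v → ¬ u ~ v
  same-colour⇒≁ e a = not-¬ (sym e) (~-colour a)

  ~-irrefl : ∀ {u} → ¬ u ~ u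
  ~-irrefl = same-colour⇒≁ refl

  ~⇒≢ : ∀ {u v} → u ~ v → u ≢ v
  ~⇒≢ a refl = ~-irrefl a

  common-neighbour⇒same-colour : ∀ {u y v} → u ~ y → y ~ v → colour u ≡ colour v
  common-neighbour⇒same-colour a b =
    trans (sym (not-involutive _)) (trans (cong not (sym (~-colour a))) (sym (~-colour b)))

  walk₃-colour : ∀ {u y z v} → u ~ y → y ~ z → z ~ v → colour v ≡ not (colour u)
  walk₃-colour a b c = trans (~-colour c) (cong not (sym (common-neighbour⇒same-colour a b)))

  infixr 5 _++ʷ_
  _++ʷ_ : ∀ {u v w} → Walk n r u v → Walk n r v w → Walk n r u w
  []      ++ʷ Q = Q
  (a ∷ P) ++ʷ Q = a ∷ (P ++ʷ Q)

  reverseʷ : ∀ {u v} → Walk n r u v → Walk n r v u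
  reverseʷ []      = []
  reverseʷ (a ∷ P) = reverseʷ P ++ʷ (~-sym a ∷ [])

  _≟ᵛ_ : DecidableEquality V
  inner i w _ ≟ᵛ inner j w′ _ with i ≟ᶠ j | List.≡-dec _≟ᵇ_ w w′
  ... | yes refl | yes refl = yes refl
  ... | no i≢j   | _        = no λ { refl → i≢j refl }
  ... | yes _    | no w≢w′  = no λ { refl → w≢w′ refl }
  inner _ _ _ ≟ᵛ leaf _ _   = no λ ()
  leaf _ _    ≟ᵛ inner _ _ _ = no λ ()
  leaf w _    ≟ᵛ leaf w′ _ with List.≡-dec _≟ᵇ_ w w′
  ... | yes refl = yes refl
  ... | no w≢w′  = no λ { refl → w≢w′ refl }

  child? : (u v : V) → Dec (Child n r u v)
  child? (inner i w _) (inner j (b ∷ w′) _) with i ≟ᶠ j | List.≡-dec _≟ᵇ_ w w′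
  ... | yes refl | yes refl = yes (inner-inner i w b _ _)
  ... | no i≢j   | _        = no λ { (inner-inner _ _ _ _ _) → i≢j refl }
  ... | yes _    | no w≢w′  = no λ { (inner-inner _ _ _ _ _) → w≢w′ refl }
  child? (inner i w _) (leaf (b ∷ w′) _) with List.≡-dec _≟ᵇ_ w w′
  ... | yes refl = yes (inner-leaf i w b _ _)
  ... | no w≢w′  = no λ { (inner-leaf _ _ _ _ _) → w≢w′ refl }
  child? (inner _ _ _) (inner _ [] _) = no λ ()
  child? (inner _ _ _) (leaf [] _)    = no λ ()
  child? (leaf _ _)    _              = no λ ()

  _~?_ : (u v : V) → Dec (u ~ v)
  u ~? v = child? u v ⊎-dec child? v u

  verticesWithWord : List Bool → List V
  verticesWithWord w with length w <? r | length w ≟ⁿ r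
  ... | yes p | _     = map (λ i → inner i w p) (allFin n)
  ... | no _  | yes q = leaf w q ∷ []
  ... | no _  | no _  = []

  ∈-verticesWithWord : ∀ x → x ∈ verticesWithWord (word x)
  ∈-verticesWithWord (inner i w p) with length w <? r | length w ≟ⁿ r
  ... | yes p′ | _ = ∈-map⁺ (λ j → inner j w p′) (∈-allFin i)
  ... | no ¬p  | _ = contradiction (recompute (_ <? _) p) ¬p
  ∈-verticesWithWord (leaf w q) with length w <? r | length w ≟ⁿ r
  ... | yes p | _     = contradiction (recompute (_ ≟ⁿ _) q) (<⇒≢ p)
  ... | no _  | yes _ = here refl
  ... | no _  | no ¬q = contradiction (recompute (_ ≟ⁿ _) q) ¬q

  vertices : List V
  vertices = concatMap verticesWithWord (concatMap words (upTo (suc r)))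

  depth≤r : ∀ x → depth x ≤ r
  depth≤r (inner _ _ p) = <⇒≤ (recompute (_ <? _) p)
  depth≤r (leaf _ q)    = ≤-reflexive (recompute (_ ≟ⁿ _) q)

  ∈-vertices : ∀ x → x ∈ vertices
  ∈-vertices x = ∈-concatMap⁺ verticesWithWord (lose word∈ (∈-verticesWithWord x))
    where
    word∈ : word x ∈ concatMap words (upTo (suc r))
    word∈ = ∈-concatMap⁺ words (lose (∈-upTo⁺ (s≤s (depth≤r x))) (∈-words (word x)))

  WalkOfLength : ℕ → V → V → Set
  WalkOfLength m u v = Σ[ P ∈ Walk n r u v ] len n r P ≡ m

  walkOfLength? : ∀ m u v → Dec (WalkOfLength m u v)
  walkOfLength? zero u v with u ≟ᵛ v
  ... | yes refl = yes ([] , refl)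
  ... | no u≢v   = no λ { ([] , _) → u≢v refl ; (_ ∷ _ , ()) }
  walkOfLength? (suc m) u v with any? (λ y → (u ~? y) ×-dec walkOfLength? m y v) vertices
  ... | yes found with find found
  ...   | _ , _ , a , P , refl = yes (a ∷ P , refl)
  walkOfLength? (suc m) u v | no none =
    no λ { ([] , ()) ; (a ∷ P , refl) → none (lose (∈-vertices _) (a , P , refl)) }

  shortest : ∀ {u v} → Walk n r u v → Σ[ P ∈ Walk n r u v ] IsShortest n r P
  shortest {u} {v} P₀ with least-witness (λ m → walkOfLength? m u v) (P₀ , refl)
  ... | _ , (P , refl) , minimal = P , λ Q → ≮⇒≥ λ Q<P → minimal Q<P (Q , refl)

  common-neighbour-walk-shortest : ∀ {u y v} → u ≢ v → (a : u ~ y) (b : y ~ v) →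
    IsShortest n r (a ∷ b ∷ [])
  common-neighbour-walk-shortest u≢v a b []          = contradiction refl u≢v
  common-neighbour-walk-shortest u≢v a b (c ∷ [])    =
    contradiction c (same-colour⇒≁ (common-neighbour⇒same-colour a b))
  common-neighbour-walk-shortest u≢v a b (_ ∷ _ ∷ _) = s≤s (s≤s z≤n)

  siblings-meet-at-parent : ∀ {i w a a′ y} .{q q′} .(p : length w < r) → a ≢ a′ →
    inner i (a ∷ w) q ~ y → y ~ inner i (a′ ∷ w) q′ → y ≡ inner i w p
  siblings-meet-at-parent _ _   ↑inner _      = refl
  siblings-meet-at-parent _ a≢a ↓inner ↑inner = contradiction refl a≢a
  siblings-meet-at-parent _ a≢a ↓leaf  ↑leaf  = contradiction refl a≢a

  grandchild-meets-at-child : ∀ {g x c y} → Child n r g x → Child n r x c → g ~ y → y ~ c → y ≡ x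
  grandchild-meets-at-child (inner-inner _ _ _ _ _) (inner-inner _ _ _ _ _) ↓inner ↓inner   = refl
  grandchild-meets-at-child (inner-inner _ _ _ _ _) (inner-leaf _ _ _ _ _)  ↓inner ↓leaf    = refl
  grandchild-meets-at-child (inner-inner _ _ _ _ _) (inner-inner _ _ _ _ _) ↓leaf  (inj₂ ())
  grandchild-meets-at-child (inner-inner _ _ _ _ _) (inner-inner _ _ _ _ _) ↑inner (inj₂ ())

  sibling≁nephew : ∀ {i w a a′ b} .{q q′} → a ≢ a′ →
    ¬ inner i (a′ ∷ w) q ~ leaf (b ∷ a ∷ w) q′
  sibling≁nephew a≢a ↓leaf = a≢a refl

  sibling→nephew-walk₃-via : ∀ {i w a a′ b y z} .{q q′} .(p : length (a ∷ w) < r) → a ≢ a′ →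
    inner i (a′ ∷ w) q ~ y → y ~ z → z ~ leaf (b ∷ a ∷ w) q′ → z ≡ inner i (a ∷ w) p
  sibling→nephew-walk₃-via _ _   ↑inner ↓inner ↓leaf = refl
  sibling→nephew-walk₃-via _ a≢a ↓inner ↑inner ↓leaf = contradiction refl a≢a
  sibling→nephew-walk₃-via _ a≢a ↓leaf  ↑leaf  ↓leaf = contradiction refl a≢a
  sibling→nephew-walk₃-via _ _   ↓inner ↓leaf  (inj₁ ())

  parent≁copy : ∀ {i j w a} .{p q} → i ≢ j → ¬ inner i w p ~ inner j (a ∷ w) q
  parent≁copy i≢i ↓inner = i≢i refl

  parent→copy-walk₃-via : ∀ {i j w a y z} .{p q} .(p′ : length (a ∷ w) < r) → i ≢ j →
    inner i w p ~ y → y ~ z → z ~ inner j (a ∷ w) q → y ≡ inner i (a ∷ w) p′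
  parent→copy-walk₃-via _ _   ↓inner ↓leaf  ↑leaf  = refl
  parent→copy-walk₃-via _ i≢i ↓inner ↓inner ↑inner = contradiction refl i≢i
  parent→copy-walk₃-via _ i≢i ↓inner ↑inner ↓inner = contradiction refl i≢i
  parent→copy-walk₃-via _ i≢i ↑inner ↓inner ↓inner = contradiction refl i≢i
  parent→copy-walk₃-via {q = q} _ _ (inj₁ (inner-leaf _ _ _ _ q′)) ↑leaf ↓inner =
    contradiction (recompute (_ ≟ⁿ _) q′) (<⇒≢ (recompute (_ <? _) q))
  parent→copy-walk₃-via _ _   ↑inner ↓leaf  (inj₁ ())
  parent→copy-walk₃-via _ _   ↑inner ↑inner (inj₂ ())

  parent~leaf : ∀ i w b .(q : suc (length w) ≡ r) → inner i w (≤-reflexive q) ~ leaf (b ∷ w) q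
  parent~leaf i w b q = inj₁ (inner-leaf i w b (≤-reflexive q) q)

  leaf-neighbour : ∀ {b w y} .{q} .(p : length w < r) → leaf (b ∷ w) q ~ y → ∃[ j ] y ≡ inner j w p
  leaf-neighbour _ (inj₂ (inner-leaf j _ _ _ _)) = j , refl

  copies-meet-at-leaf : ∀ {i j w y} .{p p′} .(q : suc (length w) ≡ r) → i ≢ j →
    inner i w p ~ y → y ~ inner j w p′ → ∃[ b ] y ≡ leaf (b ∷ w) q
  copies-meet-at-leaf _ _   (inj₁ (inner-leaf _ _ b _ _)) ↑leaf = b , refl
  copies-meet-at-leaf _ i≢i ↓inner ↑inner = contradiction refl i≢i
  copies-meet-at-leaf _ i≢i ↑inner ↓inner = contradiction refl i≢i

  module _ (S : VSet n r) where

    avoided : ∀ {u v x} (P : Walk n r u v) → Avoids n r S P → x ∈ verts n r P →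
      x ≢ u → x ≢ v → S x ≡ false
    avoided {x = x} _ P-avoids x∈P x≢u x≢v with S x in Sx
    ... | false = refl
    ... | true  = ⊥-elim ([ x≢u , x≢v ]′ (P-avoids x x∈P Sx))

    visible⇒free-midpoint : ∀ {u y₀ v} → u ≢ v → u ~ y₀ → y₀ ~ v → Visible n r S u v →
      ∃[ y ] u ~ y × y ~ v × S y ≡ false
    visible⇒free-midpoint u≢v _ _ ([] , _ , _) = contradiction refl u≢v
    visible⇒free-midpoint _ a b (c ∷ [] , _ , _) =
      contradiction c (same-colour⇒≁ (common-neighbour⇒same-colour a b))
    visible⇒free-midpoint _ _ _ (c ∷ d ∷ [] , _ , P-avoids) =
      _ , c , d , avoided (c ∷ d ∷ []) P-avoids (there (here refl)) (≢-sym (~⇒≢ c)) (~⇒≢ d)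
    visible⇒free-midpoint _ a b (_ ∷ _ ∷ _ ∷ _ , P-shortest , _) =
      contradiction (P-shortest (a ∷ b ∷ [])) λ { (s≤s (s≤s ())) }

    visible⇒free-interior₃ : ∀ {u y₀ z₀ v} → ¬ u ~ v → u ~ y₀ → y₀ ~ z₀ → z₀ ~ v →
      Visible n r S u v → ∃[ y ] ∃[ z ] u ~ y × y ~ z × z ~ v × S y ≡ false × S z ≡ false
    visible⇒free-interior₃ _ a b c ([] , _ , _) = contradiction (walk₃-colour a b c) (not-¬ refl)
    visible⇒free-interior₃ u≁v _ _ _ (d ∷ [] , _ , _) = contradiction d u≁v
    visible⇒free-interior₃ _ a b c (d ∷ e ∷ [] , _ , _) =
      contradiction (walk₃-colour a b c) (not-¬ (sym (common-neighbour⇒same-colour d e)))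
    visible⇒free-interior₃ u≁v _ _ _ (d ∷ e ∷ f ∷ [] , _ , P-avoids) =
      _ , _ , d , e , f ,
      avoided P P-avoids (there (here refl)) (≢-sym (~⇒≢ d)) (λ { refl → u≁v d }) ,
      avoided P P-avoids (there (there (here refl))) (λ { refl → u≁v f }) (~⇒≢ f)
      where P = d ∷ e ∷ f ∷ []
    visible⇒free-interior₃ _ a b c (_ ∷ _ ∷ _ ∷ _ ∷ _ , P-shortest , _) =
      contradiction (P-shortest (a ∷ b ∷ c ∷ [])) λ { (s≤s (s≤s (s≤s ()))) }

    positionable-midpoint : ∀ {u x v} → Positionable n r S u v → u ≢ v → u ~ x → x ~ v →
      S x ≡ false
    positionable-midpoint pos u≢v a b =
      avoided (a ∷ b ∷ []) (pos (a ∷ b ∷ []) (common-neighbour-walk-shortest u≢v a b))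
        (there (here refl)) (≢-sym (~⇒≢ a)) (~⇒≢ b)

    positionable⇒visible : ∀ {u v} → Walk n r u v → Positionable n r S u v → Visible n r S u v
    positionable⇒visible P₀ pos with shortest P₀
    ... | P , P-shortest = P , P-shortest , pos P P-shortest

  infix 4 _⊆ˢ_
  _⊆ˢ_ : VSet n r → VSet n r → Set
  S ⊆ˢ T = ∀ x → S x ≡ true → T x ≡ true

  HasSize-mono : ∀ {S T m k} → S ⊆ˢ T → HasSize n r S m → HasSize n r T k → m ≤ k
  HasSize-mono S⊆T (xs , refl , xs! , S⇔xs) (ys , refl , _ , T⇔ys) =
    unique-⊆⇒length≤ xs! λ {x} x∈xs → to (T⇔ys x) (S⊆T x (from (S⇔xs x) x∈xs))

  HasSize-mono-< : ∀ {S T m k x} → S ⊆ˢ T → S x ≡ false → T x ≡ true →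
    HasSize n r S m → HasSize n r T k → m < k
  HasSize-mono-< {x = x} S⊆T Sx Tx (xs , refl , xs! , S⇔xs) (ys , refl , _ , T⇔ys) =
    unique-⊆⇒length≤ (x∉xs ∷ xs!) λ
      { (here refl)  → to (T⇔ys x) Tx
      ; (there z∈xs) → to (T⇔ys _) (S⊆T _ (from (S⇔xs _) z∈xs)) }
    where
    x∉xs : All (x ≢_) xs
    x∉xs = All.tabulate λ { z∈xs refl → contradiction (trans (sym Sx) (from (S⇔xs x) z∈xs)) λ () }

  ⊆∧same-size⇒same : ∀ {S T k} → S ⊆ˢ T → HasSize n r S k → HasSize n r T k → SameSet n r S T
  ⊆∧same-size⇒same {S} {T} S⊆T |S| |T| x with S x in Sx | T x in Tx
  ... | true  | true  = refl
  ... | false | false = refl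
  ... | true  | false = contradiction (trans (sym (S⊆T x Sx)) Tx) λ ()
  ... | false | true  = contradiction (HasSize-mono-< S⊆T Sx Tx |S| |T|) (<-irrefl refl)

  HasSize-cong : ∀ {S T m} → SameSet n r S T → HasSize n r T m → HasSize n r S m
  HasSize-cong S≗T (xs , |xs| , xs! , T⇔xs) =
    xs , |xs| , xs! , λ x → mk⇔ (to (T⇔xs x) ∘ trans (sym (S≗T x))) (trans (S≗T x) ∘ from (T⇔xs x))

  IsTotalMV-cong : ∀ {S T} → SameSet n r S T → IsTotalMV n r T → IsTotalMV n r S
  IsTotalMV-cong S≗T T-total u v with T-total u v
  ... | P , P-shortest , P-avoids =
    P , P-shortest , λ x x∈P Sx → P-avoids x x∈P (trans (sym (S≗T x)) Sx)

  totalMV⇒dualMV : ∀ {S} → IsTotalMV n r S → IsDualMV n r S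
  totalMV⇒dualMV S-total = (λ u v _ _ → S-total u v) , (λ u v _ _ → S-total u v)

  totalGP⇒dualGP : ∀ {S} → IsTotalGP n r S → IsDualGP n r S
  totalGP⇒dualGP S-total = (λ u v _ _ → S-total u v) , (λ u v _ _ → S-total u v)

  ∅ : VSet n r
  ∅ _ = false

  ∅-totalGP : IsTotalGP n r ∅
  ∅-totalGP _ _ _ _ _ _ ()

  ∅-size : HasSize n r ∅ 0
  ∅-size = [] , refl , [] , λ _ → mk⇔ (λ ()) (λ ())

  LeafOnly : VSet n r → Set
  LeafOnly S = ∀ i w .(p : length w < r) → S (inner i w p) ≡ false

  SiblingFree : VSet n r → Set
  SiblingFree S =
    ∀ b w .(q : suc (length w) ≡ r) → S (leaf (b ∷ w) q) ≡ true → S (leaf (not b ∷ w) q) ≡ false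

  module DualMVStructure {S : VSet n r} (S-dual : IsDualMV n r S) where

    visible : ∀ {u v} → S u ≡ S v → Visible n r S u v
    visible {u} {v} Su≡Sv with S u in Su | S v in Sv
    ... | true  | true  = proj₁ S-dual u v Su Sv
    ... | false | false = proj₂ S-dual u v Su Sv
    ... | true  | false = contradiction Su≡Sv λ ()
    ... | false | true  = contradiction Su≡Sv λ ()

    separated : ∀ {u x v} → u ≢ v → u ~ x → x ~ v → (∀ {y} → u ~ y → y ~ v → y ≡ x) →
      S x ≡ true → S u ≢ S v
    separated u≢v a b via-x Sx Su≡Sv =
      let _ , c , d , Sy = visible⇒free-midpoint S u≢v a b (visible Su≡Sv)
      in contradiction (trans (sym Sy) (trans (cong S (via-x c d)) Sx)) λ ()

    separated₃ : ∀ {u y₀ z₀ v x} → ¬ u ~ v → u ~ y₀ → y₀ ~ z₀ → z₀ ~ v →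
      (∀ {y z} → u ~ y → y ~ z → z ~ v → y ≡ x ⊎ z ≡ x) → S x ≡ true → S u ≢ S v
    separated₃ u≁v a b c via-x Sx Su≡Sv with visible⇒free-interior₃ S u≁v a b c (visible Su≡Sv)
    ... | _ , _ , d , e , f , Sy , Sz with via-x d e f
    ...   | inj₁ refl = contradiction (trans (sym Sy) Sx) λ ()
    ...   | inj₂ refl = contradiction (trans (sym Sz) Sx) λ ()

    grandchild-separated : ∀ {g x c} → Child n r g x → Child n r x c → S x ≡ true → S g ≢ S c
    grandchild-separated g→x x→c =
      separated (grandchild-≢ g→x x→c) (inj₁ g→x) (inj₁ x→c) (grandchild-meets-at-child g→x x→c)

    siblings-separated : ∀ {i w a a′} .{p q q′} → a ≢ a′ → S (inner i w p) ≡ true →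
      S (inner i (a ∷ w) q) ≢ S (inner i (a′ ∷ w) q′)
    siblings-separated {p = p} a≢a′ =
      separated (λ e → a≢a′ (∷-injectiveˡ (cong word e))) ↑inner ↓inner
        (siblings-meet-at-parent p a≢a′)

    -- Any two of x's parent and two children have x as their only common neighbour, so their
    -- memberships would be pairwise different.
    ∉-above-inner-children : ∀ {i a w} .{p} → suc (length (a ∷ w)) < r → S (inner i (a ∷ w) p) ≢ true
    ∉-above-inner-children {i} {a} {w} {p} q Sx =
      siblings-separated (λ ()) Sx
        (≢∧≢⇒≡ (≢-sym (grandchild-separated g→x (x→c false) Sx))
               (grandchild-separated g→x (x→c true) Sx))
      where
      g→x : Child n r (inner i w (<⇒≤ p)) (inner i (a ∷ w) p)
      g→x = inner-inner i w a _ p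
      x→c : ∀ b → Child n r (inner i (a ∷ w) p) (inner i (b ∷ a ∷ w) q)
      x→c b = inner-inner i (a ∷ w) b p q

    ∉-above-leaves : ∀ {i a w} .{p} → suc (length (a ∷ w)) ≡ r → S (inner i (a ∷ w) p) ≢ true
    ∉-above-leaves {i} {a} {w} {p} q Sx = g∈S (¬-not g∉S)
      where
      g→x : Child n r (inner i w (<⇒≤ p)) (inner i (a ∷ w) p)
      g→x = inner-inner i w a _ p
      x→ℓ : ∀ b → Child n r (inner i (a ∷ w) p) (leaf (b ∷ a ∷ w) q)
      x→ℓ b = inner-leaf i (a ∷ w) b p q
      Sℓ : ∀ b → S (leaf (b ∷ a ∷ w) q) ≡ not (S (inner i w (<⇒≤ p)))
      Sℓ b = ¬-not (≢-sym (grandchild-separated g→x (x→ℓ b) Sx))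

      -- If the parent g of x were in S, the sibling of x and a leaf below x would lie outside S, yet
      -- every geodesic between them passes through x.
      g∉S : S (inner i w (<⇒≤ p)) ≢ true
      g∉S Sg =
        separated₃ (sibling≁nephew a≢¬a) ↑inner (inj₁ g→x) (inj₁ (x→ℓ false))
          (λ d e f → inj₂ (sibling→nephew-walk₃-via p a≢¬a d e f)) Sx
          (trans Sx′ (sym (trans (Sℓ false) (cong not Sg))))
        where
        a≢¬a : a ≢ not a
        a≢¬a = not-¬ refl
        Sx′ : S (inner i (not a ∷ w) p) ≡ false
        Sx′ = trans (¬-not (≢-sym (siblings-separated a≢¬a Sg))) (cong not Sx)

      -- If g were outside S, both leaves below x would be in S, so some common neighbour t of theirs is
      -- outside S; t is the copy of x in another tree, and every geodesic from g to t passes through x.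
      g∈S : S (inner i w (<⇒≤ p)) ≢ false
      g∈S Sg with visible⇒free-midpoint S (λ ()) (inj₂ (x→ℓ false)) (inj₁ (x→ℓ true))
                    (visible (trans (Sℓ false) (sym (Sℓ true))))
      ... | _ , c , _ , St with leaf-neighbour p c
      ...   | j , refl =
        separated₃ (parent≁copy i≢j) (inj₁ g→x) (inj₁ (x→ℓ false)) c
          (λ d e f → inj₁ (parent→copy-walk₃-via p i≢j d e f)) Sx (trans Sg (sym St))
        where
        i≢j : i ≢ j
        i≢j refl = contradiction (trans (sym St) Sx) λ ()

    ∉-nonroot : ∀ {i a w} .{p} → S (inner i (a ∷ w) p) ≢ true
    ∉-nonroot {a = a} {w} {p} with suc (length (a ∷ w)) <? r
    ... | yes q = ∉-above-inner-children q
    ... | no ¬q = ∉-above-leaves (≤-antisym (recompute (_ <? _) p) (≮⇒≥ ¬q))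

    ∉-root : 2 ≤ r → ∀ {i} .{p} → S (inner i [] p) ≢ true
    ∉-root 2≤r Sx =
      siblings-separated {a = false} {true} {q = 2≤r} {q′ = 2≤r} (λ ()) Sx
        (trans (¬-not ∉-nonroot) (sym (¬-not ∉-nonroot)))

    leafOnly : 2 ≤ r → LeafOnly S
    leafOnly 2≤r _ []      _ = ¬-not (∉-root 2≤r)
    leafOnly _   _ (_ ∷ _) _ = ¬-not ∉-nonroot

    siblingFree : 2 ≤ r → ∀ {i j : Fin n} → i ≢ j → SiblingFree S
    siblingFree 2≤r {i} {j} i≢j b w q Sℓ with S (leaf (not b ∷ w) q) in Sℓ′
    ... | false = refl
    ... | true with visible⇒free-midpoint S (λ { refl → i≢j refl })
                      (parent~leaf i w b q) (~-sym (parent~leaf j w b q))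
                      (visible (trans (leafOnly 2≤r i w _) (sym (leafOnly 2≤r j w _))))
    ...   | _ , c , d , Sy with copies-meet-at-leaf q i≢j c d
    ...     | b′ , refl =
      contradiction (trans (sym Sy) (b∧not-b⇒all {λ c → S (leaf (c ∷ w) q) ≡ true} b Sℓ Sℓ′ b′))
        λ ()

module GluedTree⁺ (n h : ℕ) where

  private
    r : ℕ
    r = suc h

  open GluedTree n r

  root : Fin n → V
  root i = inner i [] (s≤s z≤n)

  climb : ∀ i w .(p : length w < r) → Walk n r (inner i w p) (root i)
  climb i []      _ = []
  climb i (b ∷ w) p = inj₂ (inner-inner i w b (<⇒≤ p) p) ∷ climb i w (<⇒≤ p)

  across : ∀ m i j w .(p : length w < r) → m + length w ≡ r → Walk n r (inner i w p) (inner j w p)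
  across zero          _ _ _ p e = contradiction e (<⇒≢ (recompute (_ <? _) p))
  across (suc zero)    i j w p e = inj₁ (inner-leaf i w false p e) ∷ inj₂ (inner-leaf j w false p e) ∷ []
  across (suc (suc m)) i j w p e =
    inj₁ (inner-inner i w false p q) ∷
      across (suc m) i j (false ∷ w) q (trans (cong suc (+-suc m (length w))) e) ++ʷ
      inj₂ (inner-inner j w false p q) ∷ []
    where
    q : suc (length w) < r
    q = subst (suc (suc (length w)) ≤_) e (s≤s (s≤s (m≤n+m (length w) m)))

  toRoot : ∀ i₀ x → Walk n r x (root i₀)
  toRoot i₀ (inner i w p) =
    across (r ∸ length w) i i₀ w p (m∸n+n≡m (<⇒≤ (recompute (_ <? _) p))) ++ʷ climb i₀ w p
  toRoot i₀ (leaf (b ∷ w) q) = ~-sym (parent~leaf i₀ w b q) ∷ climb i₀ w (≤-reflexive q)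

  walk : Fin n → ∀ u v → Walk n r u v
  walk i₀ u v = toRoot i₀ u ++ʷ reverseʷ (toRoot i₀ v)

  -- Sibling leaves have the same neighbours, so replacing each interior vertex of a geodesic by its
  -- twin outside S gives a geodesic avoiding S.
  module Rerouting {S : VSet n r} (S-leafOnly : LeafOnly S) (S-siblingFree : SiblingFree S) where

    twin : V → V
    twin (inner i w p)    = inner i w p
    twin (leaf (b ∷ w) q) = leaf ((S (leaf (b ∷ w) q) xor b) ∷ w) q

    twin-∉ : ∀ x → S (twin x) ≡ false
    twin-∉ (inner i w p) = S-leafOnly i w p
    twin-∉ (leaf (b ∷ w) q) with S (leaf (b ∷ w) q) in Sℓ
    ... | false = Sℓ
    ... | true  = S-siblingFree b w q Sℓ

    ~-twinˡ : ∀ {u v} → u ~ v → twin u ~ v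
    ~-twinˡ a@↓inner = a
    ~-twinˡ a@↓leaf  = a
    ~-twinˡ a@↑inner = a
    ~-twinˡ (inj₂ (inner-leaf i w _ p q)) = inj₂ (inner-leaf i w _ p q)

    ~-twinʳ : ∀ {u v} → u ~ v → u ~ twin v
    ~-twinʳ = ~-sym ∘ ~-twinˡ ∘ ~-sym

    rerouteFrom : ∀ {y z v} → y ~ z → Walk n r z v → Walk n r (twin y) v
    rerouteFrom a []      = ~-twinˡ a ∷ []
    rerouteFrom a (b ∷ P) = ~-twinʳ (~-twinˡ a) ∷ rerouteFrom b P

    reroute : ∀ {u v} → Walk n r u v → Walk n r u v
    reroute []          = []
    reroute (a ∷ [])    = a ∷ []
    reroute (a ∷ b ∷ P) = ~-twinʳ a ∷ rerouteFrom b P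

    len-rerouteFrom : ∀ {y z v} (a : y ~ z) (P : Walk n r z v) →
      len n r (rerouteFrom a P) ≡ suc (len n r P)
    len-rerouteFrom a []      = refl
    len-rerouteFrom a (b ∷ P) = cong suc (len-rerouteFrom b P)

    len-reroute : ∀ {u v} (P : Walk n r u v) → len n r (reroute P) ≡ len n r P
    len-reroute []          = refl
    len-reroute (a ∷ [])    = refl
    len-reroute (a ∷ b ∷ P) = cong suc (len-rerouteFrom b P)

    rerouteFrom-avoids : ∀ {y z v} (a : y ~ z) (P : Walk n r z v) →
      ∀ x → x ∈ verts n r (rerouteFrom a P) → S x ≡ true → x ≡ v
    rerouteFrom-avoids {y} a []      _ (here refl)         Sx = contradiction (trans (sym Sx) (twin-∉ y)) λ ()
    rerouteFrom-avoids     a []      _ (there (here refl)) _  = refl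
    rerouteFrom-avoids {y} a (b ∷ P) _ (here refl)         Sx = contradiction (trans (sym Sx) (twin-∉ y)) λ ()
    rerouteFrom-avoids     a (b ∷ P) x (there x∈P)         Sx = rerouteFrom-avoids b P x x∈P Sx

    reroute-avoids : ∀ {u v} (P : Walk n r u v) → Avoids n r S (reroute P)
    reroute-avoids []          _ (here refl)         _  = inj₁ refl
    reroute-avoids (a ∷ [])    _ (here refl)         _  = inj₁ refl
    reroute-avoids (a ∷ [])    _ (there (here refl)) _  = inj₂ refl
    reroute-avoids (a ∷ b ∷ P) _ (here refl)         _  = inj₁ refl
    reroute-avoids (a ∷ b ∷ P) x (there x∈P)         Sx = inj₂ (rerouteFrom-avoids b P x x∈P Sx)

  leafOnly∧siblingFree⇒totalMV : Fin n → ∀ {S} → LeafOnly S → SiblingFree S → IsTotalMV n r S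
  leafOnly∧siblingFree⇒totalMV i₀ {S} S-leafOnly S-siblingFree u v with shortest (walk i₀ u v)
  ... | P , P-shortest =
    reroute P , (λ Q → subst (_≤ len n r Q) (sym (len-reroute P)) (P-shortest Q)) , reroute-avoids P
    where open Rerouting {S} S-leafOnly S-siblingFree

  dualGP⇒dualMV : Fin n → ∀ {S} → IsDualGP n r S → IsDualMV n r S
  dualGP⇒dualMV i₀ {S} (S-in , S-out) =
    (λ u v Su Sv → positionable⇒visible S (walk i₀ u v) (S-in u v Su Sv)) ,
    (λ u v Su Sv → positionable⇒visible S (walk i₀ u v) (S-out u v Su Sv))

  chosenLeaves : (List Bool → Bool) → (ws : List (List Bool)) → All (λ w → length w ≡ h) ws → List V
  chosenLeaves c []       []       = []
  chosenLeaves c (w ∷ ws) (q ∷ qs) = leaf (c w ∷ w) (cong suc q) ∷ chosenLeaves c ws qs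

  length-chosenLeaves : ∀ c ws qs → length (chosenLeaves c ws qs) ≡ length ws
  length-chosenLeaves c []       []       = refl
  length-chosenLeaves c (w ∷ ws) (q ∷ qs) = cong suc (length-chosenLeaves c ws qs)

  ∈-chosenLeaves⁺ : ∀ {c ws qs w} → w ∈ ws → .(q : suc (length w) ≡ r) →
    leaf (c w ∷ w) q ∈ chosenLeaves c ws qs
  ∈-chosenLeaves⁺ {qs = _ ∷ _} (here refl) _ = here refl
  ∈-chosenLeaves⁺ {qs = _ ∷ _} (there w∈)  q = there (∈-chosenLeaves⁺ w∈ q)

  All-chosenLeaves⁺ : ∀ {P : V → Set} {c ws qs} →
    (∀ {w} → w ∈ ws → .(q : suc (length w) ≡ r) → P (leaf (c w ∷ w) q)) →
    All P (chosenLeaves c ws qs)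
  All-chosenLeaves⁺ {ws = []}    {[]}    _    = []
  All-chosenLeaves⁺ {ws = _ ∷ _} {_ ∷ _} P-ws = P-ws (here refl) _ ∷ All-chosenLeaves⁺ (P-ws ∘ there)

  chosenLeaves-unique : ∀ {c ws qs} → Unique ws → Unique (chosenLeaves c ws qs)
  chosenLeaves-unique {qs = []}    []           = []
  chosenLeaves-unique {qs = _ ∷ _} (w≢ws ∷ ws!) =
    All-chosenLeaves⁺ (λ w′∈ _ e → All.lookup w≢ws w′∈ (∷-injectiveʳ (cong word e))) ∷
    chosenLeaves-unique ws!

  leaf-parent-length : (w : List Bool) → .(suc (length w) ≡ r) → length w ≡ h
  leaf-parent-length w q = suc-injective (recompute (suc (length w) ≟ⁿ r) q)

  transversal : BoolTree h → VSet n r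
  transversal t (inner _ _ _)    = false
  transversal t (leaf (b ∷ w) _) = does (b ≟ᵇ label t w)

  transversal-leafOnly : ∀ t → LeafOnly (transversal t)
  transversal-leafOnly t _ _ _ = refl

  transversal-siblingFree : ∀ t → SiblingFree (transversal t)
  transversal-siblingFree t b w _ b-chosen =
    dec-false (not b ≟ᵇ label t w) λ e → not-¬ refl (sym (trans e (sym (≟ᵇ-true⇒≡ b-chosen))))

  transversal-size : ∀ t → HasSize n r (transversal t) (2 ^ h)
  transversal-size t =
    xs , trans (length-chosenLeaves (label t) (words h) qs) (length-words h) ,
    chosenLeaves-unique (words-unique h) , λ x → mk⇔ (chosen⇒∈ x) (All.lookup ∈⇒chosen)
    where
    qs : All (λ w → length w ≡ h) (words h)
    qs = All.tabulate (words-length h)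
    xs : List V
    xs = chosenLeaves (label t) (words h) qs
    chosen⇒∈ : ∀ x → transversal t x ≡ true → x ∈ xs
    chosen⇒∈ (leaf (b ∷ w) q) b-chosen with ≟ᵇ-true⇒≡ {b} {label t w} b-chosen
    ... | refl =
      ∈-chosenLeaves⁺ (subst (λ d → w ∈ words d) (leaf-parent-length w q) (∈-words w)) q
    ∈⇒chosen : All (λ x → transversal t x ≡ true) xs
    ∈⇒chosen = All-chosenLeaves⁺ λ {w} _ _ → dec-true (label t w ≟ᵇ label t w) refl

  transversal-≢ : ∀ {t t′} → t ≢ t′ → ∃[ x ] transversal t x ≢ transversal t′ x
  transversal-≢ {t} t≢t′ with label-≢ t≢t′
  ... | w , q , labels≢ =
    leaf (label t w ∷ w) (cong suc q) ,
    λ e → labels≢ (≟ᵇ-true⇒≡ (trans (sym e) (dec-true (label t w ≟ᵇ label t w) refl)))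

  treeOf : VSet n r → BoolTree h
  treeOf S = tabulate h (λ w q → S (leaf (true ∷ w) (cong suc q)))

  ⊆-transversal : ∀ {S} → LeafOnly S → SiblingFree S → S ⊆ˢ transversal (treeOf S)
  ⊆-transversal S-leafOnly _ (inner i w p) Sx = contradiction (trans (sym (S-leafOnly i w p)) Sx) λ ()
  ⊆-transversal {S} _ S-siblingFree (leaf (b ∷ w) q) Sx =
    dec-true (b ≟ᵇ _) (trans (chosen b Sx) (sym (label-tabulate h _ w (leaf-parent-length w q))))
    where
    chosen : ∀ b → S (leaf (b ∷ w) q) ≡ true → b ≡ S (leaf (true ∷ w) q)
    chosen true  Sℓ = sym Sℓ
    chosen false Sℓ = sym (S-siblingFree false w q Sℓ)

  module Extremal (1≤h : 1 ≤ h) {i j : Fin n} (i≢j : i ≢ j) where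

    dualMV⇒leafOnly∧siblingFree : ∀ {S} → IsDualMV n r S → LeafOnly S × SiblingFree S
    dualMV⇒leafOnly∧siblingFree S-dual = leafOnly (s≤s 1≤h) , siblingFree (s≤s 1≤h) i≢j
      where open DualMVStructure S-dual

    dualGP⇒leafOnly : ∀ {S} → IsDualGP n r S → LeafOnly S
    dualGP⇒leafOnly = proj₁ ∘ dualMV⇒leafOnly∧siblingFree ∘ dualGP⇒dualMV i

    dualGP⇒∅ : ∀ {S} → IsDualGP n r S → SameSet n r S ∅
    dualGP⇒∅ S-gp (inner k w p)    = dualGP⇒leafOnly S-gp k w p
    dualGP⇒∅ S-gp (leaf (b ∷ w) q) =
      positionable-midpoint _ (proj₂ S-gp _ _ (dualGP⇒leafOnly S-gp i w _) (dualGP⇒leafOnly S-gp j w _))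
        (λ { refl → i≢j refl }) (parent~leaf i w b q) (~-sym (parent~leaf j w b q))

    transversal-totalMV : ∀ t → IsTotalMV n r (transversal t)
    transversal-totalMV t =
      leafOnly∧siblingFree⇒totalMV i (transversal-leafOnly t) (transversal-siblingFree t)

    module _ (P : VSet n r → Set) (P⇒dualMV : ∀ {S} → P S → IsDualMV n r S)
             (totalMV⇒P : ∀ {S} → IsTotalMV n r S → P S) where

      ⊆-transversal-of : ∀ {S} → P S → S ⊆ˢ transversal (treeOf S)
      ⊆-transversal-of P-S =
        let S-leafOnly , S-siblingFree = dualMV⇒leafOnly∧siblingFree (P⇒dualMV P-S)
        in ⊆-transversal S-leafOnly S-siblingFree

      maxSize-MV : MaxSize n r P (2 ^ h)
      maxSize-MV =
        (transversal (tabulate h λ _ _ → true) , totalMV⇒P (transversal-totalMV _) , transversal-size _) ,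
        λ S m P-S |S| → HasSize-mono (⊆-transversal-of P-S) |S| (transversal-size (treeOf S))

      numSets-MV : NumSets n r P (2 ^ h) (2 ^ 2 ^ h)
      numSets-MV =
        map transversal (trees h) ,
        trans (length-map transversal (trees h)) (length-trees h) ,
        AllPairs.map⁺ (AllPairs.map transversal-≢ (trees-unique h)) ,
        λ S → mk⇔ (maximum⇒transversal S) (transversal⇒maximum S)
        where
        maximum⇒transversal : ∀ S → P S × HasSize n r S (2 ^ h) →
          Any (SameSet n r S) (map transversal (trees h))
        maximum⇒transversal S (P-S , |S|) =
          lose (∈-map⁺ transversal (∈-trees (treeOf S)))
               (⊆∧same-size⇒same (⊆-transversal-of P-S) |S| (transversal-size (treeOf S)))
        transversal⇒maximum : ∀ S → Any (SameSet n r S) (map transversal (trees h)) →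
          P S × HasSize n r S (2 ^ h)
        transversal⇒maximum S S≗some-T with find S≗some-T
        ... | _ , T∈ , S≗T with ∈-map⁻ transversal T∈
        ...   | t , _ , refl =
          totalMV⇒P (IsTotalMV-cong S≗T (transversal-totalMV t)) , HasSize-cong S≗T (transversal-size t)

    maxSize-GP : (P : VSet n r → Set) → (∀ {S} → P S → IsDualGP n r S) → P ∅ → MaxSize n r P 0
    maxSize-GP P P⇒dualGP P-∅ =
      (∅ , P-∅ , ∅-size) ,
      λ S m P-S |S| → HasSize-mono (λ x Sx → trans (sym (dualGP⇒∅ (P⇒dualGP P-S) x)) Sx)
                        |S| ∅-size

-- Two distinct copies are all the argument needs, so only n ≥ 2 is used.
mainTheorem11 : (n r : ℕ) → 2 ≤ r → 3 ≤ n →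
    MaxSize n r (IsTotalMV n r) (2 ^ (r ∸ 1))
    × MaxSize n r (IsDualMV n r) (2 ^ (r ∸ 1))
    × NumSets n r (IsTotalMV n r) (2 ^ (r ∸ 1)) (2 ^ (2 ^ (r ∸ 1)))
    × NumSets n r (IsDualMV n r) (2 ^ (r ∸ 1)) (2 ^ (2 ^ (r ∸ 1)))
    × MaxSize n r (IsTotalGP n r) 0
    × MaxSize n r (IsDualGP n r) 0
mainTheorem11 (suc (suc n)) (suc h) (s≤s 1≤h) (s≤s (s≤s _)) =
  maxSize-MV (IsTotalMV _ _) totalMV⇒dualMV id ,
  maxSize-MV (IsDualMV _ _) id totalMV⇒dualMV ,
  numSets-MV (IsTotalMV _ _) totalMV⇒dualMV id ,
  numSets-MV (IsDualMV _ _) id totalMV⇒dualMV ,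
  maxSize-GP (IsTotalGP _ _) totalGP⇒dualGP ∅-totalGP ,
  maxSize-GP (IsDualGP _ _) id (totalGP⇒dualGP ∅-totalGP)
  where
  open GluedTree (suc (suc n)) (suc h)
  open GluedTree⁺ (suc (suc n)) h
  open Extremal 1≤h {zero} {suc zero} (λ ())
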